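{- Let $\Gamma$ be a reflexive graph and $\alpha$ an animation of $\Gamma$. Then there exists $\beta\in\mathrm{Fix}(\Gamma)$ with $\mathrm{mon}(\alpha)=\mathrm{mon}(\beta)$.
   Context: $\Gamma=(V,E)$ is a finite graph with loops allowed; it is reflexive if $v\sim v$ for every vertex $v$. An animation of $\Gamma$ is a partial function $\alpha:V\dashrightarrow V$ with $v^\alpha\sim v$ for all $v\in\mathrm{Dom}(\alpha)$; $\mathrm{mon}(\alpha)=\prod_{v\in\mathrm{Dom}(\alpha)}X_{v^\alpha}$ in $\mathbf Z[X_v:v\in V]$. A point $v$ is $\alpha$-periodic if $v^{\alpha^m}=v$ for some $m\ge1$. $\mathrm{Fix}(\Gamma)$ is the set of animations all of whose periodic points are fixed points. -}

module Defs where

open import Data.Nat using (ℕ; zero; suc; _≥_)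
open import Data.Fin using (Fin)
open import Data.Fin.Properties using (_≟_)
open import Data.Bool using (Bool; true)
open import Data.Maybe using (Maybe; just; nothing; _>>=_)
open import Data.Maybe.Properties using (≡-dec)
open import Data.List using (List; length; filter; allFin)
open import Data.Product using (Σ; _×_)
open import Relation.Binary.PropositionalEquality using (_≡_)

record Graph : Set where
  field
    n    : ℕ
    adj  : Fin n → Fin n → Bool
    sym  : ∀ u v → adj u v ≡ adj v u

open Graph public

Adjacent : (Γ : Graph) → Fin (n Γ) → Fin (n Γ) → Set
Adjacent Γ u v = adj Γ u v ≡ true

Reflexive : Graph → Set
Reflexive Γ = ∀ v → Adjacent Γ v v

-- Partial functions V ⇢ V: α v ≡ nothing means v ∉ Dom(α).
PartialMap : Graph → Set
PartialMap Γ = Fin (n Γ) → Maybe (Fin (n Γ))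

IsAnimation : (Γ : Graph) → PartialMap Γ → Set
IsAnimation Γ α = ∀ v w → α v ≡ just w → Adjacent Γ w v

-- mon(α) = ∏_{v ∈ Dom α} X_{v^α}, represented by its exponent vector:
-- the exponent of X_w is #{ v ∈ Dom α | v^α = w }.
mon : (Γ : Graph) → PartialMap Γ → Fin (n Γ) → ℕ
mon Γ α w = length (filter (λ v → ≡-dec _≟_ (α v) (just w)) (allFin (n Γ)))

iter : (Γ : Graph) → PartialMap Γ → ℕ → PartialMap Γ
iter Γ α zero    v = just v
iter Γ α (suc m) v = iter Γ α m v >>= α

Periodic : (Γ : Graph) → PartialMap Γ → Fin (n Γ) → Set
Periodic Γ α v = Σ ℕ (λ m → (m ≥ 1) × (iter Γ α m v ≡ just v))

InFix : (Γ : Graph) → PartialMap Γ → Set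
InFix Γ β = IsAnimation Γ β × (∀ v → Periodic Γ β v → β v ≡ just v)

-- Take β to fix every α-periodic point and to agree with α elsewhere. It is an animation
-- because Γ is reflexive, and a β-orbit can only close up at a point that is already
-- α-periodic, where β stops, so β ∈ Fix(Γ). For the monomials, count the preimages of each w
-- separately among periodic and aperiodic points: on aperiodic points α and β agree, and a
-- periodic w has exactly one periodic α-preimage (its predecessor on its cycle) and exactly
-- one periodic β-preimage (w itself), while an aperiodic w has none of either.
-- Periodicity is decidable since, by pigeonhole, a periodic point has a period ≤ |V|.
module Submission where

open import Defs hiding (sym)
open import Level using (0ℓ)
open import Data.Nat using (ℕ; zero; suc; _+_; _*_; _<_; s≤s; z≤n)
open import Data.Nat.Properties
  using (+-comm; +-suc; *-suc; n<1+n; m≤n⇒∃[o]m+o≡n; ≤-trans; ≤-reflexive; m≤n+m; ≤-pred)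
open import Data.Nat.Solver using (module +-*-Solver)
open import Data.Fin using (Fin; toℕ; fromℕ<)
open import Data.Fin.Properties using (_≟_; any?; pigeonhole; toℕ<n; toℕ-fromℕ<)
open import Data.Maybe using (Maybe; just; nothing; _>>=_)
open import Data.Maybe.Properties using (≡-dec; just-injective)
open import Data.List using ([]; _∷_; length; filter; allFin)
open import Data.List.Properties using (filter-≐; filter-accept; filter-reject; filter-none)
open import Data.List.Membership.Propositional using (_∈_)
open import Data.List.Membership.Propositional.Properties using (∈-allFin)
open import Data.List.Relation.Unary.All as All using ()
open import Data.List.Relation.Unary.Any using (here; there)
open import Data.List.Relation.Unary.AllPairs using (_∷_)
open import Data.List.Relation.Unary.Unique.Propositional using (Unique)
open import Data.List.Relation.Unary.Unique.Propositional.Properties using (allFin⁺)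
open import Data.Product using (Σ; ∃; _×_; _,_; proj₁; proj₂)
open import Data.Sum using (_⊎_; inj₁; inj₂)
open import Function using (_∘_)
open import Relation.Nullary using (yes; no; ¬_; contradiction)
open import Relation.Nullary.Decidable using (map′)
open import Relation.Unary using (Pred; Decidable; _≐_)
open import Relation.Unary.Properties using (_∩?_; ∁?)
open import Relation.Binary using (DecidableEquality)
open import Relation.Binary.PropositionalEquality
  using (_≡_; refl; sym; trans; cong; cong₂; subst; module ≡-Reasoning)

module _ {a p q} {A : Set a} {P : Pred A p} {Q : Pred A q} (P? : Decidable P) (Q? : Decidable Q) where

  length-filter-∩-∁ : ∀ xs → length (filter P? xs)
    ≡ length (filter (P? ∩? Q?) xs) + length (filter (P? ∩? ∁? Q?) xs)
  length-filter-∩-∁ [] = refl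
  length-filter-∩-∁ (x ∷ xs) with P? x | Q? x
  ... | yes _ | yes _ = cong suc (length-filter-∩-∁ xs)
  ... | yes _ | no _  = trans (cong suc (length-filter-∩-∁ xs)) (sym (+-suc _ _))
  ... | no _  | _     = length-filter-∩-∁ xs

module _ {a} {A : Set a} (_≡?_ : DecidableEquality A) where

  length-filter-≡-unique : ∀ {x xs} → Unique xs → x ∈ xs → length (filter (_≡? x) xs) ≡ 1
  length-filter-≡-unique {xs = y ∷ ys} (y≢ys ∷ _) (here refl) = begin
    length (filter (_≡? y) (y ∷ ys)) ≡⟨ cong length (filter-accept (_≡? y) refl) ⟩
    suc (length (filter (_≡? y) ys)) ≡⟨ cong (suc ∘ length) (filter-none (_≡? y) ys≢y) ⟩
    1                                ∎
    where
      open ≡-Reasoning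
      ys≢y = All.map (λ y≢z z≡y → y≢z (sym z≡y)) y≢ys
  length-filter-≡-unique (y≢ys ∷ ys-unique) (there x∈ys) =
    trans (cong length (filter-reject (_≡? _) (All.lookup y≢ys x∈ys)))
          (length-filter-≡-unique ys-unique x∈ys)

>>=-just : ∀ {a b} {A : Set a} {B : Set b} (mx : Maybe A) {f : A → Maybe B} {y} →
  (mx >>= f) ≡ just y → ∃ λ x → mx ≡ just x
>>=-just (just x) _ = x , refl

module Iteration (Γ : Graph) (α : PartialMap Γ) where

  iter-+ : ∀ a b v → iter Γ α (a + b) v ≡ (iter Γ α b v >>= iter Γ α a)
  iter-+ zero b v with iter Γ α b v
  ... | just _  = refl
  ... | nothing = refl
  iter-+ (suc a) b v rewrite iter-+ a b v with iter Γ α b v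
  ... | just _  = refl
  ... | nothing = refl

  iter-+-just : ∀ a {b v x} → iter Γ α b v ≡ just x → iter Γ α (a + b) v ≡ iter Γ α a x
  iter-+-just a {b} {v} e = trans (iter-+ a b v) (cong (_>>= iter Γ α a) e)

  iter-sucˡ : ∀ m v → iter Γ α (suc m) v ≡ (α v >>= iter Γ α m)
  iter-sucˡ m v = trans (cong (λ k → iter Γ α k v) (+-comm 1 m)) (iter-+ m 1 v)

  iter-*-period : ∀ {m v} → iter Γ α m v ≡ just v → ∀ k → iter Γ α (k * m) v ≡ just v
  iter-*-period e zero    = refl
  iter-*-period {m} e (suc k) = trans (iter-+-just m (iter-*-period {m} e k)) e

  iter-+-period : ∀ {m v} → iter Γ α m v ≡ just v → ∀ a k → iter Γ α (a + k * m) v ≡ iter Γ α a v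
  iter-+-period {m} e a k = iter-+-just a (iter-*-period {m} e k)

  iter-*-suc-period : ∀ {m v} → iter Γ α (suc m) v ≡ just v → ∀ k → iter Γ α (k * m + k) v ≡ just v
  iter-*-suc-period {m} {v} e k =
    trans (cong (λ j → iter Γ α j v) (trans (+-comm (k * m) k) (sym (*-suc k m)))) (iter-*-period {suc m} e k)

  period-orbit : ∀ {m v x} k → iter Γ α m v ≡ just v → iter Γ α k v ≡ just x → iter Γ α m x ≡ just x
  period-orbit zero e refl = e
  period-orbit {m} {v} {x} (suc k) e e′ with iter Γ α k v in eq
  ... | just y = begin
    iter Γ α m x          ≡⟨ cong (_>>= iter Γ α m) (sym e′) ⟩
    (α y >>= iter Γ α m)  ≡⟨ sym (iter-sucˡ m y) ⟩
    (iter Γ α m y >>= α)  ≡⟨ cong (_>>= α) (period-orbit {m} k e eq) ⟩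
    α y                   ≡⟨ e′ ⟩
    just x                ∎
    where open ≡-Reasoning

  periodic-orbit : ∀ {v x} k → Periodic Γ α v → iter Γ α k v ≡ just x → Periodic Γ α x
  periodic-orbit k (m , m≥1 , e) e′ = m , m≥1 , period-orbit {m} k e e′

  periodic-iter-defined : ∀ {v} → Periodic Γ α v → ∀ k → ∃ λ x → iter Γ α k v ≡ just x
  periodic-iter-defined {v} (suc m , _ , e) k =
    >>=-just (iter Γ α k v) (trans (sym (iter-+ (k * m) k v)) (iter-*-suc-period {m} e k))

  periodic-predecessor : ∀ {w} → Periodic Γ α w →
    ∃ λ p → (λ u → α u ≡ just w × Periodic Γ α u) ≐ (_≡ p)
  periodic-predecessor {w} pw@(suc k , _ , ew) =
    p , predecessor-unique , λ { refl → αp≡w , periodic-orbit k pw ek }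
    where
      open ≡-Reasoning
      p = proj₁ (>>=-just (iter Γ α k w) ew)
      ek : iter Γ α k w ≡ just p
      ek = proj₂ (>>=-just (iter Γ α k w) ew)
      αp≡w : α p ≡ just w
      αp≡w = trans (cong (_>>= α) (sym ek)) ew
      -- Both u and p are reached from w after (1 + m)(1 + k) − 1 steps.
      predecessor-unique : ∀ {u} → α u ≡ just w × Periodic Γ α u → u ≡ p
      predecessor-unique {u} (αu≡w , suc m , _ , eu) = just-injective (begin
        just u                      ≡⟨ sym eu ⟩
        iter Γ α (suc m) u          ≡⟨ iter-sucˡ m u ⟩
        (α u >>= iter Γ α m)        ≡⟨ cong (_>>= iter Γ α m) αu≡w ⟩
        iter Γ α m w                ≡⟨ sym (iter-+-period {suc m} w-period-suc-m m k) ⟩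
        iter Γ α (m + k * suc m) w  ≡⟨ cong (λ j → iter Γ α j w) (m+k*[1+m]≡k+m*[1+k] m k) ⟩
        iter Γ α (k + m * suc k) w  ≡⟨ iter-+-period {suc k} ew k m ⟩
        iter Γ α k w                ≡⟨ ek ⟩
        just p                      ∎)
        where
          w-period-suc-m : iter Γ α (suc m) w ≡ just w
          w-period-suc-m = period-orbit {suc m} 1 eu αu≡w
          m+k*[1+m]≡k+m*[1+k] : ∀ m k → m + k * suc m ≡ k + m * suc k
          m+k*[1+m]≡k+m*[1+k] = solve 2 (λ m k → m :+ k :* (con 1 :+ m) := k :+ m :* (con 1 :+ k)) refl
            where open +-*-Solver

  -- Pigeonhole on the first n + 1 iterates gives a point x = v^(α^i) of period d ≤ n;
  -- as v lies on the orbit of x, it has period d as well.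
  periodic-bounded : ∀ {v} → Periodic Γ α v → ∃ λ d → d < n Γ × iter Γ α (suc d) v ≡ just v
  periodic-bounded {v} pv@(suc m , _ , e)
    with i , j , i<j , same ← pigeonhole (n<1+n (n Γ)) (proj₁ ∘ periodic-iter-defined pv ∘ toℕ)
    with d , i+d≡j ← m≤n⇒∃[o]m+o≡n i<j
    = d , d<n , period-orbit {suc d} (toℕ i * m) x-period x↦v
    where
      d<n : d < n Γ
      d<n = ≤-trans (s≤s (m≤n+m d (toℕ i))) (≤-trans (≤-reflexive i+d≡j) (≤-pred (toℕ<n j)))
      x = proj₁ (periodic-iter-defined pv (toℕ i))
      v↦x : iter Γ α (toℕ i) v ≡ just x
      v↦x = proj₂ (periodic-iter-defined pv (toℕ i))
      x-period : iter Γ α (suc d) x ≡ just x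
      x-period = begin
        iter Γ α (suc d) x          ≡⟨ sym (iter-+-just (suc d) v↦x) ⟩
        iter Γ α (suc d + toℕ i) v  ≡⟨ cong (λ k → iter Γ α k v) (trans (cong suc (+-comm d (toℕ i))) i+d≡j) ⟩
        iter Γ α (toℕ j) v          ≡⟨ proj₂ (periodic-iter-defined pv (toℕ j)) ⟩
        just _                      ≡⟨ cong just (sym same) ⟩
        just x                      ∎
        where open ≡-Reasoning
      x↦v : iter Γ α (toℕ i * m) x ≡ just v
      x↦v = trans (sym (iter-+-just (toℕ i * m) v↦x)) (iter-*-suc-period {m} e (toℕ i))

  periodic? : Decidable (Periodic Γ α)
  periodic? v = map′ from to (any? λ i → ≡-dec _≟_ (iter Γ α (suc (toℕ i)) v) (just v))
    where
      from : (∃ λ i → iter Γ α (suc (toℕ i)) v ≡ just v) → Periodic Γ α v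
      from (i , e) = suc (toℕ i) , s≤s z≤n , e
      to : Periodic Γ α v → ∃ λ i → iter Γ α (suc (toℕ i)) v ≡ just v
      to pv with d , d<n , e ← periodic-bounded pv =
        fromℕ< d<n , subst (λ k → iter Γ α (suc k) v ≡ just v) (sym (toℕ-fromℕ< d<n)) e

module FixPeriodic (Γ : Graph) (α : PartialMap Γ) where

  open Iteration Γ α

  fixPeriodic : PartialMap Γ
  fixPeriodic v with periodic? v
  ... | yes _ = just v
  ... | no _  = α v

  fixPeriodic-periodic : ∀ {v} → Periodic Γ α v → fixPeriodic v ≡ just v
  fixPeriodic-periodic {v} pv with periodic? v
  ... | yes _   = refl
  ... | no ¬pv  = contradiction pv ¬pv

  fixPeriodic-aperiodic : ∀ {v} → ¬ Periodic Γ α v → fixPeriodic v ≡ α v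
  fixPeriodic-aperiodic {v} ¬pv with periodic? v
  ... | yes pv = contradiction pv ¬pv
  ... | no _   = refl

  fixPeriodic-periodic-preimage : ∀ {v w} → Periodic Γ α v → fixPeriodic v ≡ just w → v ≡ w
  fixPeriodic-periodic-preimage pv e = just-injective (trans (sym (fixPeriodic-periodic pv)) e)

  fixPeriodic-animation : Reflexive Γ → IsAnimation Γ α → IsAnimation Γ fixPeriodic
  fixPeriodic-animation reflexive animation v w e with periodic? v
  ... | yes _ = subst (λ u → Adjacent Γ u v) (just-injective e) (reflexive v)
  ... | no _  = animation v w e

  fixPeriodic-orbit : ∀ k {v x} → iter Γ fixPeriodic k v ≡ just x →
    iter Γ α k v ≡ just x ⊎ Periodic Γ α x
  fixPeriodic-orbit zero e = inj₁ e
  fixPeriodic-orbit (suc k) {v} e with y , ey ← >>=-just (iter Γ fixPeriodic k v) e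
    rewrite ey with periodic? y | fixPeriodic-orbit k ey
  ... | yes py | _       = inj₂ (subst (Periodic Γ α) (just-injective e) py)
  ... | no _   | inj₁ ea = inj₁ (trans (cong (_>>= α) ea) e)
  ... | no ¬py | inj₂ py = contradiction py ¬py

  fixPeriodic-fixes-periodic : ∀ v → Periodic Γ fixPeriodic v → fixPeriodic v ≡ just v
  fixPeriodic-fixes-periodic v (m , m≥1 , e) with periodic? v
  ... | yes _ = refl
  ... | no ¬pv with fixPeriodic-orbit m e
  ...   | inj₁ ea = contradiction (m , m≥1 , ea) ¬pv
  ...   | inj₂ pv = contradiction pv ¬pv

  module _ (w : Fin (n Γ)) where

    private
      α↦w? : Decidable (λ v → α v ≡ just w)
      α↦w? v = ≡-dec _≟_ (α v) (just w)
      β↦w? : Decidable (λ v → fixPeriodic v ≡ just w)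
      β↦w? v = ≡-dec _≟_ (fixPeriodic v) (just w)
      vertices = allFin (n Γ)
      count : ∀ {P : Pred (Fin (n Γ)) 0ℓ} → Decidable P → ℕ
      count P? = length (filter P? vertices)

      count-singleton : ∀ p → count (_≟ p) ≡ 1
      count-singleton p = length-filter-≡-unique _≟_ (allFin⁺ (n Γ)) (∈-allFin p)

    periodic-preimages : count (α↦w? ∩? periodic?) ≡ count (β↦w? ∩? periodic?)
    periodic-preimages with periodic? w
    ... | yes pw with p , α-preimage≐p ← periodic-predecessor pw = begin
      count (α↦w? ∩? periodic?) ≡⟨ cong length (filter-≐ _ (_≟ p) α-preimage≐p vertices) ⟩
      count (_≟ p)              ≡⟨ trans (count-singleton p) (sym (count-singleton w)) ⟩
      count (_≟ w)              ≡⟨ cong length (filter-≐ (_≟ w) _ β-preimage≐w vertices) ⟩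
      count (β↦w? ∩? periodic?) ∎
      where
        open ≡-Reasoning
        β-preimage≐w : (_≡ w) ≐ (λ v → fixPeriodic v ≡ just w × Periodic Γ α v)
        β-preimage≐w = (λ { refl → fixPeriodic-periodic pw , pw })
                     , λ (βv≡w , pv) → fixPeriodic-periodic-preimage pv βv≡w
    ... | no ¬pw = cong length (filter-≐ _ _ (α-preimage-⊥ , β-preimage-⊥) vertices)
      where
        α-preimage-⊥ : ∀ {v} → α v ≡ just w × Periodic Γ α v → fixPeriodic v ≡ just w × Periodic Γ α v
        α-preimage-⊥ (αv≡w , pv) = contradiction (periodic-orbit 1 pv αv≡w) ¬pw
        β-preimage-⊥ : ∀ {v} → fixPeriodic v ≡ just w × Periodic Γ α v → α v ≡ just w × Periodic Γ α v
        β-preimage-⊥ (βv≡w , pv) = contradiction (subst (Periodic Γ α) (fixPeriodic-periodic-preimage pv βv≡w) pv) ¬pw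

    aperiodic-preimages : count (α↦w? ∩? ∁? periodic?) ≡ count (β↦w? ∩? ∁? periodic?)
    aperiodic-preimages = cong length (filter-≐ _ _ (α⇒β , β⇒α) vertices)
      where
        α⇒β : ∀ {v} → α v ≡ just w × ¬ Periodic Γ α v → fixPeriodic v ≡ just w × ¬ Periodic Γ α v
        α⇒β (αv≡w , ¬pv) = trans (fixPeriodic-aperiodic ¬pv) αv≡w , ¬pv
        β⇒α : ∀ {v} → fixPeriodic v ≡ just w × ¬ Periodic Γ α v → α v ≡ just w × ¬ Periodic Γ α v
        β⇒α (βv≡w , ¬pv) = trans (sym (fixPeriodic-aperiodic ¬pv)) βv≡w , ¬pv

    fixPeriodic-mon : mon Γ α w ≡ mon Γ fixPeriodic w
    fixPeriodic-mon = begin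
      mon Γ α w                                                 ≡⟨ length-filter-∩-∁ α↦w? periodic? vertices ⟩
      count (α↦w? ∩? periodic?) + count (α↦w? ∩? ∁? periodic?)  ≡⟨ cong₂ _+_ periodic-preimages aperiodic-preimages ⟩
      count (β↦w? ∩? periodic?) + count (β↦w? ∩? ∁? periodic?)  ≡⟨ sym (length-filter-∩-∁ β↦w? periodic? vertices) ⟩
      mon Γ fixPeriodic w                                       ∎
      where open ≡-Reasoning

lemma7p7 : (Γ : Graph) → Reflexive Γ → (α : PartialMap Γ) → IsAnimation Γ α →
    Σ (PartialMap Γ) (λ β → InFix Γ β × (∀ w → mon Γ α w ≡ mon Γ β w))
lemma7p7 Γ reflexive α animation =
  fixPeriodic , (fixPeriodic-animation reflexive animation , fixPeriodic-fixes-periodic) , fixPeriodic-mon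
  where open FixPeriodic Γ α
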